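{- For every integer $n\ge 3$ and every $i\in\{1,\ldots,n-2\}$, $fw(1\,2\ldots n\;1\,2\ldots(n-1)\;i\;n)=4$.
   Context: Sequences are written as concatenations of letters. A sequence $s$ contains $u$ if some (not necessarily contiguous) subsequence of $s$ can be changed into $u$ by a one-to-one renaming of letters. An $(r,s)$-formation is a concatenation of $s$ permutations, each of the same set of $r$ distinct letters. The formation width $fw(u)$ is the minimum $s$ such that there exists $r$ for which every $(r,s)$-formation contains $u$. -}

module Defs where

open import Data.Nat using (ℕ; suc; _∸_; _<_)
open import Data.List using (List; []; _∷_; _++_; map; concat; length; upTo)
open import Data.List.Relation.Binary.Sublist.Propositional using (_⊆_)
open import Data.List.Relation.Binary.Permutation.Propositional using (_↭_)
open import Data.List.Relation.Unary.All using (All)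
open import Data.List.Relation.Unary.Unique.Propositional using (Unique)
open import Data.List.Membership.Propositional using (_∈_)
open import Data.Product using (Σ; _×_; ∃)
open import Relation.Binary.PropositionalEquality using (_≡_)
open import Relation.Nullary using (¬_)

Seq : Set
Seq = List ℕ

Contains : Seq → Seq → Set
Contains s u =
  Σ Seq λ t → (t ⊆ s) × Σ (ℕ → ℕ) λ f →
    (∀ {x y} → x ∈ t → y ∈ t → f x ≡ f y → x ≡ y) × (map f t ≡ u)

IsFormation : ℕ → ℕ → Seq → Set
IsFormation r s w =
  Σ Seq λ L → Unique L × (length L ≡ r) ×
    Σ (List Seq) λ ps → (length ps ≡ s) × All (_↭ L) ps × (concat ps ≡ w)

FormationForced : Seq → ℕ → Set
FormationForced u s = ∃ λ r → ∀ w → IsFormation r s w → Contains w u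

FwIs : Seq → ℕ → Set
FwIs u k = FormationForced u k × (∀ s → s < k → ¬ FormationForced u s)

pat : ℕ → ℕ → Seq
pat n i = map suc (upTo n) ++ map suc (upTo (n ∸ 1)) ++ (i ∷ n ∷ [])

-- Upper bound: Erdős–Szekeres, applied in turn to the second, third and fourth of four
-- permutations of r letters, leaves n letters whose order in each permutation is that of the
-- first one or its reverse. The pattern embeds in each of the eight words so obtained, after
-- renaming its letters to positions so that it splits into monotone runs matching the
-- orientations.
-- Lower bound: the prefixes of L, reverse L, reverse L avoid the subpattern i n i i n, since
-- its three i's force i and n to occur in both orders in L.
module Submission where

open import Defs
open import Data.Bool using (Bool; true; false)
open import Data.Nat using (ℕ; zero; suc; pred; _+_; _∸_; _≤_; _<_; z≤n; s≤s; _≟_; _≤?_)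
open import Data.Nat.Properties
open import Data.Nat.DivMod using (_%_; m<n⇒m%n≡m; n%n≡0; m%n<n)
open import Data.List
  using (List; []; _∷_; _++_; map; concat; length; upTo; downFrom; applyUpTo; reverse; take; drop)
open import Data.List.Properties
  using (map-++; map-∘; map-id; map-id-local; map-upTo; upTo-∷ʳ; reverse-upTo; reverse-map;
         ++-assoc; ++-identityʳ; reverse-involutive; unfold-reverse; length-upTo; length-take;
         take++drop≡id; concat-++)
open import Data.List.Membership.Propositional using (_∈_)
open import Data.List.Membership.Propositional.Properties
  using (∈-map⁺; ∈-map⁻; ∈-++⁻; ∈-∃++; ∈-upTo⁺; ∈-upTo⁻)
open import Data.List.Relation.Unary.Any using (here; there)
import Data.List.Relation.Unary.Any.Properties as Any
open import Data.List.Relation.Unary.All as All using (All; []; _∷_)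
import Data.List.Relation.Unary.All.Properties as All
open import Data.List.Relation.Unary.AllPairs using ([]; _∷_)
open import Data.List.Relation.Unary.Unique.Propositional using (Unique)
open import Data.List.Relation.Unary.Unique.Propositional.Properties using (upTo⁺)
open import Data.List.Relation.Binary.Sublist.Propositional
  using (_⊆_; []; _∷_; _∷ʳ_; ⊆-refl; ⊆-trans; ⊆-reflexive; minimum; from∈)
open import Data.List.Relation.Binary.Sublist.Propositional.Properties
  using (++⁺; ++⁺ˡ; ++⁺ʳ; map⁺; reverse⁺; All-resp-⊆; Any-resp-⊆)
open import Data.List.Relation.Binary.Permutation.Propositional using (_↭_; ↭-refl; ↭-sym; ↭⇒↭ₛ)
open import Data.List.Relation.Binary.Permutation.Propositional.Properties
  using (∈-resp-↭; ↭-length; ↭-reverse)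
open import Data.List.Relation.Binary.Permutation.Setoid.Properties using (Unique-resp-↭)
open import Data.Product using (Σ; _×_; _,_; proj₂)
open import Data.Sum using (_⊎_; inj₁; inj₂)
open import Function using (_∘_; case_of_)
open import Relation.Binary.PropositionalEquality
  using (_≡_; _≢_; refl; sym; trans; cong; cong₂; subst; subst₂; setoid; module ≡-Reasoning)
open import Relation.Nullary using (¬_; yes; no; contradiction)

InjectiveOn : (ℕ → ℕ) → Seq → Set
InjectiveOn f u = ∀ {x y} → x ∈ u → y ∈ u → f x ≡ f y → x ≡ y

-- A left inverse of f on u, found by linear search (junk value 0 outside f[u]).
invertOn : (ℕ → ℕ) → Seq → ℕ → ℕ
invertOn f []      y = 0
invertOn f (x ∷ u) y with f x ≟ y
... | yes _ = x
... | no  _ = invertOn f u y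

invertOn-inverts : ∀ {f u x} → InjectiveOn f u → x ∈ u → invertOn f u (f x) ≡ x
invertOn-inverts {f} {y ∷ u} {x} f-inj x∈ with f y ≟ f x | x∈
... | yes fy≡fx | _         = f-inj (here refl) x∈ fy≡fx
... | no  fy≢fx | here refl = contradiction refl fy≢fx
... | no  _     | there x∈u = invertOn-inverts (λ p q → f-inj (there p) (there q)) x∈u

map-invertOn : ∀ {f u} → InjectiveOn f u → map (invertOn f u) (map f u) ≡ u
map-invertOn {u = u} f-inj =
  trans (sym (map-∘ u)) (map-id-local (All.tabulate (invertOn-inverts f-inj)))

invertOn-injective : ∀ {f u} → InjectiveOn f u → InjectiveOn (invertOn f u) (map f u)
invertOn-injective {f} f-inj x∈ y∈ e with ∈-map⁻ f x∈ | ∈-map⁻ f y∈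
... | a , a∈ , refl | b , b∈ , refl =
  cong f (trans (sym (invertOn-inverts f-inj a∈)) (trans e (invertOn-inverts f-inj b∈)))

renaming⇒contains : ∀ {w u} k → InjectiveOn k u → map k u ⊆ w → Contains w u
renaming⇒contains {u = u} k k-inj ku⊆w =
  map k u , ku⊆w , invertOn k u , invertOn-injective k-inj , map-invertOn k-inj

contains⇒renaming : ∀ {w u} → Contains w u →
  Σ (ℕ → ℕ) λ k → InjectiveOn k u × map k u ⊆ w
contains⇒renaming (t , t⊆w , f , f-inj , refl) =
  invertOn f t , invertOn-injective f-inj , subst (_⊆ _) (sym (map-invertOn f-inj)) t⊆w

injectiveOn-∘ : ∀ {h g u v} → InjectiveOn h v → map g u ⊆ v → InjectiveOn g u →
  InjectiveOn (h ∘ g) u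
injectiveOn-∘ {g = g} h-inj gu⊆v g-inj x∈ y∈ e =
  g-inj x∈ y∈ (h-inj (Any-resp-⊆ gu⊆v (∈-map⁺ g x∈)) (Any-resp-⊆ gu⊆v (∈-map⁺ g y∈)) e)

contains-trans : ∀ {w v u} → Contains w v → Contains v u → Contains w u
contains-trans {u = u} c₁ c₂ with contains⇒renaming c₁ | contains⇒renaming c₂
... | h , h-inj , hv⊆w | g , g-inj , gu⊆v =
  renaming⇒contains (h ∘ g) (injectiveOn-∘ h-inj gu⊆v g-inj)
    (subst (_⊆ _) (sym (map-∘ u)) (⊆-trans (map⁺ h gu⊆v) hv⊆w))

unique-⊆ : ∀ {xs ys : Seq} → xs ⊆ ys → Unique ys → Unique xs
unique-⊆ []         ys!        = ys!
unique-⊆ (_ ∷ʳ xs⊆) (_ ∷ ys!)  = unique-⊆ xs⊆ ys!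
unique-⊆ (refl ∷ xs⊆) (y∉ ∷ ys!) = All-resp-⊆ xs⊆ y∉ ∷ unique-⊆ xs⊆ ys!

unique-↭ : ∀ {xs ys : Seq} → xs ↭ ys → Unique ys → Unique xs
unique-↭ xs↭ys = Unique-resp-↭ (setoid ℕ) (↭⇒↭ₛ (↭-sym xs↭ys))

partition⊎ : ∀ {P R : ℕ → Set} (S : Seq) → All (λ y → P y ⊎ R y) S →
  Σ Seq λ A → Σ Seq λ B →
    A ⊆ S × B ⊆ S × All P A × All R B × length A + length B ≡ length S
partition⊎ [] [] = [] , [] , [] , [] , [] , [] , refl
partition⊎ (y ∷ S) (py⊎ry ∷ pS) with partition⊎ S pS | py⊎ry
... | A , B , A⊆S , B⊆S , pA , rB , eq | inj₁ py =
  y ∷ A , B , refl ∷ A⊆S , y ∷ʳ B⊆S , py ∷ pA , rB , cong suc eq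
... | A , B , A⊆S , B⊆S , pA , rB , eq | inj₂ ry =
  A , y ∷ B , y ∷ʳ A⊆S , refl ∷ B⊆S , pA , ry ∷ rB ,
  trans (+-suc (length A) (length B)) (cong suc eq)

m+n≤o+p⇒m≤o⊎n≤p : ∀ m n o p → m + n ≤ o + p → m ≤ o ⊎ n ≤ p
m+n≤o+p⇒m≤o⊎n≤p m n o p m+n≤o+p with m ≤? o | n ≤? p
... | yes m≤o | _       = inj₁ m≤o
... | no  _   | yes n≤p = inj₂ n≤p
... | no  m≰o | no  n≰p = contradiction m+n≤o+p (<⇒≱ (+-mono-< (≰⇒> m≰o) (≰⇒> n≰p)))

esBound : ℕ → ℕ → ℕ
esBound zero    _       = 0
esBound (suc _) zero    = 0
esBound (suc a) (suc b) = suc (esBound a (suc b) + esBound (suc a) b)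

HasMonotone : ℕ → ℕ → Seq → Seq → Set
HasMonotone a b S Q =
  Σ Seq λ S′ → S′ ⊆ S × (a ≤ length S′ × S′ ⊆ Q ⊎ b ≤ length S′ × reverse S′ ⊆ Q)

extend-after : ∀ {a b x A S} Q₁ {Q₂} → A ⊆ S → HasMonotone a (suc b) A Q₂ →
  HasMonotone (suc a) (suc b) (x ∷ S) (Q₁ ++ x ∷ Q₂)
extend-after Q₁ A⊆S (S′ , S′⊆A , inj₁ (l , inc)) =
  _ ∷ S′ , refl ∷ ⊆-trans S′⊆A A⊆S , inj₁ (s≤s l , ++⁺ˡ Q₁ (refl ∷ inc))
extend-after Q₁ A⊆S (S′ , S′⊆A , inj₂ (l , dec)) =
  S′ , _ ∷ʳ ⊆-trans S′⊆A A⊆S , inj₂ (l , ++⁺ˡ Q₁ (_ ∷ʳ dec))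

extend-before : ∀ {a b x B S Q₁} Q₂ → B ⊆ S → HasMonotone (suc a) b B Q₁ →
  HasMonotone (suc a) (suc b) (x ∷ S) (Q₁ ++ x ∷ Q₂)
extend-before Q₂ B⊆S (S′ , S′⊆B , inj₁ (l , inc)) =
  S′ , _ ∷ʳ ⊆-trans S′⊆B B⊆S , inj₁ (l , ++⁺ʳ (_ ∷ Q₂) inc)
extend-before {x = x} Q₂ B⊆S (S′ , S′⊆B , inj₂ (l , dec)) =
  x ∷ S′ , refl ∷ ⊆-trans S′⊆B B⊆S ,
  inj₂ (s≤s l , subst (_⊆ _) (sym (unfold-reverse x S′)) (++⁺ dec (refl ∷ minimum Q₂)))

∈-++-∷⁻ : ∀ {x y : ℕ} Q₁ {Q₂} → x ≢ y → y ∈ Q₁ ++ x ∷ Q₂ → y ∈ Q₂ ⊎ y ∈ Q₁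
∈-++-∷⁻ Q₁ x≢y y∈ with ∈-++⁻ Q₁ y∈
... | inj₁ y∈Q₁         = inj₂ y∈Q₁
... | inj₂ (here refl)  = contradiction refl x≢y
... | inj₂ (there y∈Q₂) = inj₁ y∈Q₂

-- Split S behind its head x into the letters after x in Q and those before x, and recurse
-- on whichever part is long enough; x extends an increasing run of the first part or a
-- decreasing run of the second.
erdős-szekeres : ∀ a b {S Q} → Unique S → All (_∈ Q) S → esBound a b ≤ length S →
  HasMonotone a b S Q
erdős-szekeres zero    _       _ _ _ = [] , minimum _ , inj₁ (z≤n , minimum _)
erdős-szekeres (suc a) zero    _ _ _ = [] , minimum _ , inj₂ (z≤n , minimum _)
erdős-szekeres (suc a) (suc b) {x ∷ S} (x∉S ∷ S!) (x∈Q ∷ S⊆Q) (s≤s bound)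
  with Q₁ , Q₂ , refl ← ∈-∃++ x∈Q
  with A , B , A⊆S , B⊆S , A⊆Q₂ , B⊆Q₁ , |A|+|B| ←
         partition⊎ {_∈ Q₂} {_∈ Q₁} S
           (All.zipWith (λ (x≢y , y∈Q) → ∈-++-∷⁻ Q₁ x≢y y∈Q) (x∉S , S⊆Q))
  with m+n≤o+p⇒m≤o⊎n≤p (esBound a (suc b)) (esBound (suc a) b) (length A) (length B)
         (subst (_ ≤_) (sym |A|+|B|) bound)
... | inj₁ long-A =
  extend-after Q₁ A⊆S (erdős-szekeres a (suc b) (unique-⊆ A⊆S S!) A⊆Q₂ long-A)
... | inj₂ long-B =
  extend-before Q₂ B⊆S (erdős-szekeres (suc a) b (unique-⊆ B⊆S S!) B⊆Q₁ long-B)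

orient : Bool → Seq → Seq
orient true  xs = xs
orient false xs = reverse xs

Oriented : Seq → Seq → Set
Oriented S Q = Σ Bool λ b → orient b S ⊆ Q

orient⁺ : ∀ b {xs ys} → xs ⊆ ys → orient b xs ⊆ orient b ys
orient⁺ true  = λ xs⊆ys → xs⊆ys
orient⁺ false = reverse⁺

map-orient : ∀ f b xs → map f (orient b xs) ≡ orient b (map f xs)
map-orient f true  xs = refl
map-orient f false xs = reverse-map f xs

∈-orient⁺ : ∀ b {x xs} → x ∈ xs → x ∈ orient b xs
∈-orient⁺ true  = λ x∈ → x∈
∈-orient⁺ false = Any.reverse⁺

∈-orient⁻ : ∀ b {x xs} → x ∈ orient b xs → x ∈ xs
∈-orient⁻ true  = λ x∈ → x∈
∈-orient⁻ false = Any.reverse⁻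

oriented-⊆ : ∀ {S′ S Q} → S′ ⊆ S → Oriented S Q → Oriented S′ Q
oriented-⊆ S′⊆S (b , o) = b , ⊆-trans (orient⁺ b S′⊆S) o

oriented-subsequence : ∀ k {S Q} → Unique S → All (_∈ Q) S → esBound k k ≤ length S →
  Σ Seq λ S′ → S′ ⊆ S × k ≤ length S′ × Oriented S′ Q
oriented-subsequence k S! S⊆Q bound with erdős-szekeres k k S! S⊆Q bound
... | S′ , S′⊆S , inj₁ (l , inc) = S′ , S′⊆S , l , true , inc
... | S′ , S′⊆S , inj₂ (l , dec) = S′ , S′⊆S , l , false , dec

iteratedBound : ℕ → ℕ → ℕ
iteratedBound k zero    = k
iteratedBound k (suc j) = esBound (iteratedBound k j) (iteratedBound k j)

common-oriented-subsequence : ∀ k Qs {S} → Unique S →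
  All (λ Q → All (_∈ Q) S) Qs → iteratedBound k (length Qs) ≤ length S →
  Σ Seq λ S′ → S′ ⊆ S × k ≤ length S′ × All (Oriented S′) Qs
common-oriented-subsequence k []       S! _            bound = _ , ⊆-refl , bound , []
common-oriented-subsequence k (Q ∷ Qs) S! (S⊆Q ∷ S⊆Qs) bound
  with S₁ , S₁⊆S , bound₁ , o ← oriented-subsequence _ S! S⊆Q bound
  with S′ , S′⊆S₁ , l , os ← common-oriented-subsequence k Qs (unique-⊆ S₁⊆S S!)
                               (All.map (All-resp-⊆ S₁⊆S) S⊆Qs) bound₁
  = S′ , ⊆-trans S′⊆S₁ S₁⊆S , l , oriented-⊆ S′⊆S₁ o ∷ os

nth : Seq → ℕ → ℕ
nth []       _       = 0
nth (x ∷ _)  zero    = x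
nth (_ ∷ xs) (suc k) = nth xs k

applyUpTo-nth : ∀ S {n} → n ≤ length S → applyUpTo (nth S) n ⊆ S
applyUpTo-nth S       {zero}  _         = minimum S
applyUpTo-nth (x ∷ S) {suc n} (s≤s n≤) = refl ∷ applyUpTo-nth S n≤

nth-∈ : ∀ S {k} → k < length S → nth S k ∈ S
nth-∈ (x ∷ S) {zero}  _         = here refl
nth-∈ (x ∷ S) {suc k} (s≤s k<) = there (nth-∈ S k<)

nth-injective : ∀ {S j k} → Unique S → j < length S → k < length S →
  nth S j ≡ nth S k → j ≡ k
nth-injective {x ∷ S} {zero}  {zero}  _          _         _         _ = refl
nth-injective {x ∷ S} {zero}  {suc k} (x∉S ∷ _)  _         (s≤s k<) e =
  contradiction e (All.lookup x∉S (nth-∈ S k<))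
nth-injective {x ∷ S} {suc j} {zero}  (x∉S ∷ _)  (s≤s j<) _         e =
  contradiction (sym e) (All.lookup x∉S (nth-∈ S j<))
nth-injective {x ∷ S} {suc j} {suc k} (_ ∷ S!)   (s≤s j<) (s≤s k<) e =
  cong suc (nth-injective S! j< k< e)

map-++⁺ : ∀ (f : ℕ → ℕ) xs {xs′ ys ys′ : Seq} → map f xs ⊆ ys → map f xs′ ⊆ ys′ →
  map f (xs ++ xs′) ⊆ ys ++ ys′
map-++⁺ f xs p q = subst (_⊆ _) (sym (map-++ f xs _)) (++⁺ p q)

-- The positions 0 … n-1 of a common oriented subsequence, as they occur in the four permutations.
positionWord : ℕ → Bool → Bool → Bool → Seq
positionWord n b₂ b₃ b₄ =
  upTo n ++ orient b₂ (upTo n) ++ orient b₃ (upTo n) ++ orient b₄ (upTo n) ++ []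

orient-upTo-bounded : ∀ b n → All (_< n) (orient b (upTo n))
orient-upTo-bounded b n = All.tabulate (∈-upTo⁻ ∘ ∈-orient⁻ b)

positionWord-bounded : ∀ n b₂ b₃ b₄ → All (_< n) (positionWord n b₂ b₃ b₄)
positionWord-bounded n b₂ b₃ b₄ =
  All.++⁺ (orient-upTo-bounded true n) (All.++⁺ (orient-upTo-bounded b₂ n)
    (All.++⁺ (orient-upTo-bounded b₃ n) (All.++⁺ (orient-upTo-bounded b₄ n) [])))

positionWord-embeds : ∀ {n S P₁ P₂ P₃ P₄ b₂ b₃ b₄} → Unique S → n ≤ length S →
  S ⊆ P₁ → orient b₂ S ⊆ P₂ → orient b₃ S ⊆ P₃ → orient b₄ S ⊆ P₄ →
  Contains (P₁ ++ P₂ ++ P₃ ++ P₄ ++ []) (positionWord n b₂ b₃ b₄)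
positionWord-embeds {n} {S} {b₂ = b₂} {b₃} {b₄} S! n≤|S| S⊆P₁ o₂ o₃ o₄ =
  renaming⇒contains (nth S) nth-inj
    (map-++⁺ (nth S) N (block true S⊆P₁)
      (map-++⁺ (nth S) (orient b₂ N) (block b₂ o₂)
        (map-++⁺ (nth S) (orient b₃ N) (block b₃ o₃)
          (map-++⁺ (nth S) (orient b₄ N) (block b₄ o₄) []))))
  where
  N = upTo n
  nth-inj : InjectiveOn (nth S) (positionWord n b₂ b₃ b₄)
  nth-inj x∈ y∈ = nth-injective S! (in-S x∈) (in-S y∈)
    where in-S = λ {x} x∈ → <-≤-trans (All.lookup (positionWord-bounded n b₂ b₃ b₄) {x} x∈) n≤|S|
  block : ∀ b {P} → orient b S ⊆ P → map (nth S) (orient b N) ⊆ P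
  block b o = subst (_⊆ _) (sym (map-orient (nth S) b N))
    (⊆-trans (orient⁺ b (subst (_⊆ S) (sym (map-upTo (nth S) n)) (applyUpTo-nth S n≤|S|))) o)

upTo-⊆-upTo-suc : ∀ m → upTo m ⊆ upTo (suc m)
upTo-⊆-upTo-suc m = subst (upTo m ⊆_) (upTo-∷ʳ m) (++⁺ʳ _ ⊆-refl)

map-suc-upTo-⊆ : ∀ m → map suc (upTo m) ⊆ upTo (suc m)
map-suc-upTo-⊆ m = 0 ∷ʳ ⊆-reflexive (map-upTo suc m)

pair-⊆-upTo : ∀ {x y} n → x < y → y < n → x ∷ y ∷ [] ⊆ upTo n
pair-⊆-upTo (suc n) x<y (s≤s y≤n) =
  subst (_ ⊆_) (upTo-∷ʳ n) (case m≤n⇒m<n∨m≡n y≤n of λ where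
    (inj₁ y<n)  → ++⁺ʳ _ (pair-⊆-upTo n x<y y<n)
    (inj₂ refl) → ++⁺ (from∈ (∈-upTo⁺ x<y)) ⊆-refl)

singleton-⊆-orient-upTo : ∀ b {x n} → x < n → x ∷ [] ⊆ orient b (upTo n)
singleton-⊆-orient-upTo b x<n = from∈ (∈-orient⁺ b (∈-upTo⁺ x<n))

map-∸-upTo : ∀ n → map (λ k → n ∸ suc k) (upTo n) ≡ downFrom n
map-∸-upTo zero    = refl
map-∸-upTo (suc n) = cong (n ∷_) (begin
  map (λ k → suc n ∸ suc k) (applyUpTo suc n)   ≡⟨ cong (map _) (sym (map-upTo suc n)) ⟩
  map (λ k → suc n ∸ suc k) (map suc (upTo n))  ≡⟨ sym (map-∘ (upTo n)) ⟩
  map (λ k → n ∸ suc k) (upTo n)                ≡⟨ map-∸-upTo n ⟩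
  downFrom n                                    ∎)
  where open ≡-Reasoning

reflect-⊆ : ∀ m (g : ℕ → ℕ) xs → map g xs ⊆ upTo (suc m) →
  map (λ a → m ∸ g a) xs ⊆ reverse (upTo (suc m))
reflect-⊆ m g xs gxs⊆ =
  subst₂ _⊆_ (sym (map-∘ xs)) (trans (map-∸-upTo (suc m)) (sym (reverse-upTo (suc m))))
    (map⁺ (m ∸_) gxs⊆)

map-pred-suc : ∀ xs → map pred (map suc xs) ≡ xs
map-pred-suc xs = trans (sym (map-∘ xs)) (map-id xs)

Letter : ℕ → ℕ → Set
Letter n a = 1 ≤ a × a ≤ n

LetterInjective : ℕ → (ℕ → ℕ) → Set
LetterInjective n g = ∀ {a b} → Letter n a → Letter n b → g a ≡ g b → a ≡ b

map-suc-upTo-letters : ∀ {k n} → k ≤ n → All (Letter n) (map suc (upTo k))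
map-suc-upTo-letters k≤n = All.tabulate λ a∈ → case ∈-map⁻ suc a∈ of λ where
  (j , j∈ , refl) → s≤s z≤n , ≤-trans (∈-upTo⁻ j∈) k≤n

pat-letters : ∀ {m i} → 1 ≤ i → i < m → All (Letter (suc m)) (pat (suc m) i)
pat-letters 1≤i i<m =
  All.++⁺ (map-suc-upTo-letters ≤-refl) (All.++⁺ (map-suc-upTo-letters (n≤1+n _))
    ((1≤i , m≤n⇒m≤1+n (<⇒≤ i<m)) ∷ (s≤s z≤n , ≤-refl) ∷ []))

pred-letterInjective : ∀ {n} → LetterInjective n pred
pred-letterInjective (s≤s z≤n , _) (s≤s z≤n , _) e = cong suc e

unrotate : ℕ → ℕ → ℕ
unrotate n zero    = n
unrotate n (suc a) = suc a

unrotate-% : ∀ {m a} → Letter (suc m) a → unrotate (suc m) (a % suc m) ≡ a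
unrotate-% {m} {suc a} (s≤s z≤n , a≤n) with m≤n⇒m<n∨m≡n a≤n
... | inj₁ a<n  = cong (unrotate (suc m)) (m<n⇒m%n≡m a<n)
... | inj₂ refl = cong (unrotate (suc m)) (n%n≡0 (suc m))

%-letterInjective : ∀ {m} → LetterInjective (suc m) (_% suc m)
%-letterInjective {m} la lb e =
  trans (sym (unrotate-% la)) (trans (cong (unrotate (suc m)) e) (unrotate-% lb))

reflect-letterInjective : ∀ {m g} → LetterInjective (suc m) g →
  (∀ {a} → Letter (suc m) a → g a ≤ m) → LetterInjective (suc m) (λ a → m ∸ g a)
reflect-letterInjective g-inj g≤m la lb e = g-inj la lb (∸-cancelˡ-≡ (g≤m la) (g≤m lb) e)

-- One case per orientation of the last three copies (with the second copy forward, the last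
-- two do not matter). The pattern is renamed to positions by pred (n ↦ n-1) or by _% n
-- (n ↦ 0), possibly followed by the reflection k ↦ m ∸ k.
module PatternInPositionWords {m i : ℕ} (1≤i : 1 ≤ i) (i<m : i < m) where

  private
    n = suc m
    N = upTo n
    A = map suc (upTo m)

  by-renaming : ∀ g {V} → LetterInjective n g → map g (pat n i) ⊆ V → Contains V (pat n i)
  by-renaming g g-inj = renaming⇒contains g λ a∈ b∈ →
    g-inj (All.lookup (pat-letters 1≤i i<m) a∈) (All.lookup (pat-letters 1≤i i<m) b∈)

  pat-pieces : pat n i ≡ A ++ n ∷ A ++ i ∷ n ∷ []
  pat-pieces = begin
    map suc (upTo n) ++ rest            ≡⟨ cong (λ xs → map suc xs ++ rest) (sym (upTo-∷ʳ m)) ⟩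
    map suc (upTo m ++ m ∷ []) ++ rest  ≡⟨ cong (_++ rest) (map-++ suc (upTo m) (m ∷ [])) ⟩
    (A ++ n ∷ []) ++ rest               ≡⟨ ++-assoc A (n ∷ []) rest ⟩
    A ++ n ∷ rest                       ∎
    where
    open ≡-Reasoning
    rest = A ++ i ∷ n ∷ []

  i<n : i < n
  i<n = m<n⇒m<1+n i<m

  pred-≤ : ∀ {a} → Letter n a → pred a ≤ m
  pred-≤ (_ , a≤n) = pred-mono-≤ a≤n

  %-≤ : ∀ {a} → Letter n a → a % n ≤ m
  %-≤ {a} _ = m<1+n⇒m≤n (m%n<n a n)

  pred-upTo : map pred (map suc N) ⊆ N
  pred-upTo = ⊆-reflexive (map-pred-suc N)

  pred-A : map pred A ⊆ N
  pred-A = ⊆-trans (⊆-reflexive (map-pred-suc (upTo m))) (upTo-⊆-upTo-suc m)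

  pred-tail : map pred (i ∷ n ∷ []) ⊆ N
  pred-tail = pair-⊆-upTo n (≤-<-trans (pred-mono-≤ (n≤1+n i)) i<m) ≤-refl

  %-fixes-A : map (_% n) A ≡ A
  %-fixes-A = map-id-local (All.tabulate λ a∈ →
    m<n⇒m%n≡m (s≤s (proj₂ (All.lookup (map-suc-upTo-letters ≤-refl) a∈))))

  %-A : map (_% n) A ⊆ N
  %-A = subst (_⊆ N) (sym %-fixes-A) (map-suc-upTo-⊆ m)

  %-nA : map (_% n) (n ∷ A) ⊆ N
  %-nA = ⊆-reflexive (cong₂ _∷_ (n%n≡0 n) (trans %-fixes-A (map-upTo suc m)))

  %-tail : map (_% n) (i ∷ n ∷ []) ≡ i ∷ 0 ∷ []
  %-tail = cong₂ (λ x y → x ∷ y ∷ []) (m<n⇒m%n≡m i<n) (n%n≡0 n)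

  %-tail-backward : map (_% n) (i ∷ n ∷ []) ⊆ reverse N
  %-tail-backward = subst (_⊆ reverse N) (sym %-tail) (reverse⁺ (pair-⊆-upTo n 1≤i i<n))

  reflect-%-tail : map (λ a → m ∸ a % n) (i ∷ n ∷ []) ⊆ N
  reflect-%-tail = subst (_⊆ N) (cong (map (m ∸_)) (sym %-tail))
    (pair-⊆-upTo n (∸-monoʳ-< 1≤i (<⇒≤ i<m)) ≤-refl)

  forward : ∀ b₃ b₄ → Contains (positionWord n true b₃ b₄) (pat n i)
  forward b₃ b₄ = by-renaming pred pred-letterInjective
    (map-++⁺ pred (map suc N) pred-upTo (map-++⁺ pred A pred-A
      (++⁺ (singleton-⊆-orient-upTo b₃ (≤-<-trans (pred-mono-≤ (n≤1+n i)) i<n))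
           (++⁺ (singleton-⊆-orient-upTo b₄ ≤-refl) []))))

  backward-forward-forward : Contains (positionWord n false true true) (pat n i)
  backward-forward-forward = by-renaming pred pred-letterInjective
    (map-++⁺ pred (map suc N) pred-upTo
      (++⁺ˡ (reverse N) (map-++⁺ pred A pred-A (++⁺ʳ [] pred-tail))))

  backward-backward-backward : Contains (positionWord n false false false) (pat n i)
  backward-backward-backward = by-renaming g (reflect-letterInjective pred-letterInjective pred-≤)
    (++⁺ˡ N (map-++⁺ g (map suc N) (reflect-⊆ m pred (map suc N) pred-upTo)
      (map-++⁺ g A (reflect-⊆ m pred A pred-A)
        (++⁺ʳ [] (reflect-⊆ m pred (i ∷ n ∷ []) pred-tail)))))
    where g = λ a → m ∸ pred a

  backward-forward-backward : Contains (positionWord n false true false) (pat n i)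
  backward-forward-backward = by-renaming (_% n) %-letterInjective
    (subst (λ u → map (_% n) u ⊆ positionWord n false true false) (sym pat-pieces)
      (map-++⁺ (_% n) A %-A (++⁺ (singleton-⊆-orient-upTo false (m%n<n n n))
        (map-++⁺ (_% n) A %-A (++⁺ʳ [] %-tail-backward)))))

  backward-backward-forward : Contains (positionWord n false false true) (pat n i)
  backward-backward-forward = by-renaming g (reflect-letterInjective %-letterInjective %-≤)
    (subst (λ u → map g u ⊆ positionWord n false false true) (sym pat-pieces)
      (++⁺ˡ N (map-++⁺ g A (reflect-⊆ m (_% n) A %-A)
        (map-++⁺ g (n ∷ A) (reflect-⊆ m (_% n) (n ∷ A) %-nA) (++⁺ʳ [] reflect-%-tail)))))
    where g = λ a → m ∸ a % n

positionWord-contains-pat : ∀ {m i} → 1 ≤ i → i < m → ∀ b₂ b₃ b₄ →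
  Contains (positionWord (suc m) b₂ b₃ b₄) (pat (suc m) i)
positionWord-contains-pat 1≤i i<m true  b₃    b₄    = forward b₃ b₄
  where open PatternInPositionWords 1≤i i<m
positionWord-contains-pat 1≤i i<m false true  true  = backward-forward-forward
  where open PatternInPositionWords 1≤i i<m
positionWord-contains-pat 1≤i i<m false true  false = backward-forward-backward
  where open PatternInPositionWords 1≤i i<m
positionWord-contains-pat 1≤i i<m false false true  = backward-backward-forward
  where open PatternInPositionWords 1≤i i<m
positionWord-contains-pat 1≤i i<m false false false = backward-backward-backward
  where open PatternInPositionWords 1≤i i<m

permutations-share-letters : ∀ {P Q L : Seq} → P ↭ L → Q ↭ L → All (_∈ Q) P
permutations-share-letters p q = All.tabulate (∈-resp-↭ (↭-sym q) ∘ ∈-resp-↭ p)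

four-permutations-contain-pat : ∀ {m i L P₁ P₂ P₃ P₄} → 1 ≤ i → i < m → Unique L →
  length L ≡ iteratedBound (suc m) 3 → P₁ ↭ L → P₂ ↭ L → P₃ ↭ L → P₄ ↭ L →
  Contains (P₁ ++ P₂ ++ P₃ ++ P₄ ++ []) (pat (suc m) i)
four-permutations-contain-pat {m} {i} {L} {P₁} {P₂} {P₃} {P₄} 1≤i i<m L! |L| p₁ p₂ p₃ p₄ =
  embed (common-oriented-subsequence (suc m) (P₂ ∷ P₃ ∷ P₄ ∷ []) P₁!
          (shared p₂ ∷ shared p₃ ∷ shared p₄ ∷ [])
          (≤-reflexive (sym (trans (↭-length p₁) |L|))))
  where
  P₁! = unique-↭ p₁ L!
  shared : ∀ {Q} → Q ↭ L → All (_∈ Q) P₁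
  shared = permutations-share-letters p₁
  embed : (Σ Seq λ S → S ⊆ P₁ × suc m ≤ length S × All (Oriented S) (P₂ ∷ P₃ ∷ P₄ ∷ [])) →
    Contains (P₁ ++ P₂ ++ P₃ ++ P₄ ++ []) (pat (suc m) i)
  embed (S , S⊆P₁ , n≤|S| , (b₂ , o₂) ∷ (b₃ , o₃) ∷ (b₄ , o₄) ∷ []) = contains-trans
    (positionWord-embeds {b₂ = b₂} {b₃} {b₄} (unique-⊆ S⊆P₁ P₁!) n≤|S| S⊆P₁ o₂ o₃ o₄)
    (positionWord-contains-pat 1≤i i<m b₂ b₃ b₄)

pat-forced-by-4 : ∀ {m i} → 1 ≤ i → i < m → FormationForced (pat (suc m) i) 4
pat-forced-by-4 {m} {i} 1≤i i<m = iteratedBound (suc m) 3 , forced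
  where
  forced : ∀ w → IsFormation (iteratedBound (suc m) 3) 4 w → Contains w (pat (suc m) i)
  forced _ (L , L! , |L| , _ ∷ _ ∷ _ ∷ _ ∷ [] , _ , p₁ ∷ p₂ ∷ p₃ ∷ p₄ ∷ [] , refl) =
    four-permutations-contain-pat 1≤i i<m L! |L| p₁ p₂ p₃ p₄

⊆-++⁻ : ∀ ys {zs xs : Seq} → xs ⊆ ys ++ zs → Σ ℕ λ k → take k xs ⊆ ys × drop k xs ⊆ zs
⊆-++⁻ []       xs⊆zs = 0 , [] , xs⊆zs
⊆-++⁻ (y ∷ ys) (_ ∷ʳ xs⊆) with k , p , q ← ⊆-++⁻ ys xs⊆ = k , y ∷ʳ p , q
⊆-++⁻ (y ∷ ys) (refl ∷ xs⊆) with k , p , q ← ⊆-++⁻ ys xs⊆ = suc k , refl ∷ p , q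

¬unique-xx : ∀ {x : ℕ} {ys} → ¬ Unique (x ∷ x ∷ ys)
¬unique-xx ((x≢x ∷ _) ∷ _) = x≢x refl

¬unique-xyx : ∀ {x y : ℕ} {ys} → ¬ Unique (x ∷ y ∷ x ∷ ys)
¬unique-xyx ((_ ∷ x≢x ∷ _) ∷ _) = x≢x refl

¬unique-yxx : ∀ {x y : ℕ} {ys} → ¬ Unique (y ∷ x ∷ x ∷ ys)
¬unique-yxx (_ ∷ xxys!) = ¬unique-xx xxys!

¬both-orders : ∀ {L : Seq} {a b} → Unique L → a ≢ b → a ∷ b ∷ [] ⊆ L → ¬ (b ∷ a ∷ [] ⊆ L)
¬both-orders (_ ∷ L!)   a≢b (_ ∷ʳ ab) (_ ∷ʳ ba)  = ¬both-orders L! a≢b ab ba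
¬both-orders (a∉L ∷ _)  _   (refl ∷ _) (_ ∷ʳ ba) =
  All.lookup a∉L (Any-resp-⊆ ba (there (here refl))) refl
¬both-orders (b∉L ∷ _)  _   (_ ∷ʳ ab) (refl ∷ _) =
  All.lookup b∉L (Any-resp-⊆ ab (there (here refl))) refl
¬both-orders _          a≢b (refl ∷ _) (refl ∷ _) = a≢b refl

reverse-pair : ∀ {L : Seq} {x y} → x ∷ y ∷ [] ⊆ reverse L → y ∷ x ∷ [] ⊆ L
reverse-pair {L} xy = subst (_ ⊆_) (reverse-involutive L) (reverse⁺ xy)

reversalFormation : Seq → List Seq
reversalFormation L = L ∷ reverse L ∷ reverse L ∷ []

-- Each copy of L holds a at most once, so the three a's fall into the three copies; the
-- b before the second a and the b after the third then put a and b in both orders in L.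
abaab-avoided : ∀ {L a b} → Unique L → a ≢ b →
  ¬ (a ∷ b ∷ a ∷ a ∷ b ∷ [] ⊆ concat (reversalFormation L))
abaab-avoided {L} {a} {b} L! a≢b abaab⊆
  with k , in-L , rest ← ⊆-++⁻ L abaab⊆
  with k′ , in-R₁ , in-R₂ ← ⊆-++⁻ (reverse L) rest
  = split k k′ in-L in-R₁ (subst (_ ⊆_) (++-identityʳ (reverse L)) in-R₂)
  where
  R! : Unique (reverse L)
  R! = unique-↭ (↭-reverse L) L!
  X = a ∷ b ∷ a ∷ a ∷ b ∷ []
  split : ∀ k k′ → take k X ⊆ L → take k′ (drop k X) ⊆ reverse L →
    ¬ (drop k′ (drop k X) ⊆ reverse L)
  split (suc (suc (suc _))) _   p _ _ = ¬unique-xyx (unique-⊆ p L!)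
  split 0 0                     _ _ r = ¬unique-xyx (unique-⊆ r R!)
  split 0 1                     _ _ r = ¬unique-yxx (unique-⊆ r R!)
  split 0 2                     _ _ r = ¬unique-xx (unique-⊆ r R!)
  split 0 (suc (suc (suc _)))   _ q _ = ¬unique-xyx (unique-⊆ q R!)
  split 1 0                     _ _ r = ¬unique-yxx (unique-⊆ r R!)
  split 1 1                     _ _ r = ¬unique-xx (unique-⊆ r R!)
  split 1 2                     _ q r = ¬both-orders L! a≢b (reverse-pair q) (reverse-pair r)
  split 1 (suc (suc (suc _)))   _ q _ = ¬unique-yxx (unique-⊆ q R!)
  split 2 0                     _ _ r = ¬unique-xx (unique-⊆ r R!)
  split 2 1                     p _ r = ¬both-orders L! a≢b p (reverse-pair r)
  split 2 (suc (suc _))         _ q _ = ¬unique-xx (unique-⊆ q R!)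

concat-take-⊆ : ∀ s (xss : List Seq) → concat (take s xss) ⊆ concat xss
concat-take-⊆ s xss =
  subst (concat (take s xss) ⊆_)
    (trans (concat-++ (take s xss) (drop s xss)) (cong concat (take++drop≡id s xss)))
    (++⁺ʳ _ ⊆-refl)

reversalFormation-prefix : ∀ r s → s ≤ 3 →
  IsFormation r s (concat (take s (reversalFormation (upTo r))))
reversalFormation-prefix r s s≤3 =
  upTo r , upTo⁺ r , length-upTo r , take s _ , trans (length-take s _) (m≤n⇒m⊓n≡m s≤3) ,
  All.take⁺ s (↭-refl ∷ ↭-reverse _ ∷ ↭-reverse _ ∷ []) , refl

abaab-⊆-pat : ∀ {m i} → 1 ≤ i → i < m → i ∷ suc m ∷ i ∷ i ∷ suc m ∷ [] ⊆ pat (suc m) i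
abaab-⊆-pat {m} {suc i} (s≤s z≤n) i+1<m =
  ++⁺ (map⁺ suc (pair-⊆-upTo (suc m) i<m ≤-refl))
      (++⁺ (from∈ (∈-map⁺ suc (∈-upTo⁺ i<m))) ⊆-refl)
  where i<m = ≤-trans (n≤1+n (suc i)) i+1<m

pat-unforced-below-4 : ∀ {m i} → 1 ≤ i → i < m → ∀ s → s < 4 →
  ¬ FormationForced (pat (suc m) i) s
pat-unforced-below-4 {m} {i} 1≤i i<m s (s≤s s≤3) (r , forced)
  with k , k-inj , kpat⊆w ← contains⇒renaming (forced _ (reversalFormation-prefix r s s≤3))
  = abaab-avoided (upTo⁺ r)
      (λ e → <⇒≢ (m<n⇒m<1+n i<m) (k-inj (∈pat (here refl)) (∈pat (there (here refl))) e))
      (⊆-trans (map⁺ k (abaab-⊆-pat 1≤i i<m)) (⊆-trans kpat⊆w (concat-take-⊆ s _)))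
  where
  ∈pat : ∀ {x} → x ∈ i ∷ suc m ∷ i ∷ i ∷ suc m ∷ [] → x ∈ pat (suc m) i
  ∈pat = Any-resp-⊆ (abaab-⊆-pat 1≤i i<m)

lemma10 : (n i : ℕ) → 3 ≤ n → 1 ≤ i → i ≤ n ∸ 2 → FwIs (pat n i) 4
lemma10 (suc (suc (suc k))) i (s≤s (s≤s (s≤s z≤n))) 1≤i i≤k+1 =
  pat-forced-by-4 1≤i (s≤s i≤k+1) , pat-unforced-below-4 1≤i (s≤s i≤k+1)
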